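{- Let $G$ be a minimal counterexample (as defined in the context). Then the minimum degree of $G$ satisfies $\delta(G)\geq 3$.
   Context: All graphs are finite and simple. A 2-distance $16$-coloring of a graph is a coloring of its vertices with $16$ colors such that any two distinct vertices at distance at most $2$ receive different colors. A minimal counterexample is a planar graph $G$ with maximum degree at most $5$ that admits no 2-distance $16$-coloring, and such that $|V(G)|+|E(G)|$ is minimum among all planar graphs with maximum degree at most $5$ admitting no 2-distance $16$-coloring. -}

module Defs where

open import Data.Nat using (ℕ; zero; suc; _+_; _≤_; _<_; _<ᵇ_)
open import Data.Fin using (Fin; zero; suc; toℕ; inject₁; fromℕ)
open import Data.Bool using (Bool; true; false; if_then_else_; _∧_)
open import Data.List using (List; map; allFin)
open import Data.Nat.ListAction using (sum)
open import Data.Product using (Σ; _×_; _,_; proj₁; proj₂)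
open import Data.Sum using (_⊎_)
open import Data.Rational using (ℚ; 0ℚ; 1ℚ) renaming (_+_ to _+ℚ_; _*_ to _*ℚ_; _-_ to _-ℚ_; _≤_ to _≤ℚ_)
open import Relation.Binary.PropositionalEquality using (_≡_; _≢_)
open import Relation.Nullary using (¬_)

record Graph : Set where
  field
    n      : ℕ
    adj    : Fin n → Fin n → Bool
    sym    : ∀ u v → adj u v ≡ adj v u
    irrefl : ∀ u → adj u u ≡ false
open Graph public

Adj : (G : Graph) → Fin (n G) → Fin (n G) → Set
Adj G u v = adj G u v ≡ true

deg : (G : Graph) → Fin (n G) → ℕ
deg G u = sum (map (λ v → if adj G u v then 1 else 0) (allFin (n G)))

numEdges : Graph → ℕ
numEdges G = sum (map (λ u → sum (map (λ v → if (toℕ u <ᵇ toℕ v) ∧ adj G u v then 1 else 0)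
                                     (allFin (n G))))
                      (allFin (n G)))

size : Graph → ℕ
size G = n G + numEdges G

MaxDegAtMost : ℕ → Graph → Set
MaxDegAtMost k G = ∀ u → deg G u ≤ k

WithinDist2 : (G : Graph) → Fin (n G) → Fin (n G) → Set
WithinDist2 G u v = Adj G u v ⊎ Σ (Fin (n G)) (λ w → Adj G u w × Adj G w v)

TwoDistanceColoring : (k : ℕ) (G : Graph) → (Fin (n G) → Fin k) → Set
TwoDistanceColoring k G c = ∀ u v → u ≢ v → WithinDist2 G u v → c u ≢ c v

TwoDistanceColorable : ℕ → Graph → Set
TwoDistanceColorable k G = Σ (Fin (n G) → Fin k) (TwoDistanceColoring k G)

-- Planarity, following Diestel: a plane graph has vertices as distinct
-- points of the plane and edges as polygonal arcs (finite unions of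
-- straight segments) between their endpoints, whose interiors contain no
-- vertex and no point of another edge.

Pt : Set
Pt = ℚ × ℚ

OnSeg : Pt → Pt → Pt → Set
OnSeg p a b = Σ ℚ λ t → (0ℚ ≤ℚ t) × (t ≤ℚ 1ℚ)
  × (proj₁ p ≡ proj₁ a +ℚ t *ℚ (proj₁ b -ℚ proj₁ a))
  × (proj₂ p ≡ proj₂ a +ℚ t *ℚ (proj₂ b -ℚ proj₂ a))

record PolyPath : Set where
  field
    len : ℕ
    pt  : Fin (suc (suc len)) → Pt

  start : Pt
  start = pt zero

  end : Pt
  end = pt (fromℕ (suc len))

  OnSegment : Fin (suc len) → Pt → Set
  OnSegment i p = OnSeg p (pt (inject₁ i)) (pt (suc i))

  OnPath : Pt → Set
  OnPath p = Σ (Fin (suc len)) λ i → OnSegment i p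

  IsArc : Set
  IsArc = ∀ (i j : Fin (suc len)) → toℕ i < toℕ j → ∀ p → OnSegment i p → OnSegment j p →
          (toℕ j ≡ suc (toℕ i)) × (p ≡ pt (suc i))
open PolyPath public

Edge : Graph → Set
Edge G = Σ (Fin (n G) × Fin (n G)) λ e → (toℕ (proj₁ e) < toℕ (proj₂ e)) × Adj G (proj₁ e) (proj₂ e)

IsEnd : (G : Graph) → Edge G → Fin (n G) → Set
IsEnd G e x = (x ≡ proj₁ (proj₁ e)) ⊎ (x ≡ proj₂ (proj₁ e))

record PlaneDrawing (G : Graph) : Set where
  field
    pos       : Fin (n G) → Pt
    pos-inj   : ∀ u v → pos u ≡ pos v → u ≡ v
    arc       : Edge G → PolyPath
    arc-isArc : ∀ e → IsArc (arc e)
    arc-start : ∀ e → start (arc e) ≡ pos (proj₁ (proj₁ e))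
    arc-end   : ∀ e → end (arc e) ≡ pos (proj₂ (proj₁ e))
    arc-avoids-vertices : ∀ e w → OnPath (arc e) (pos w) → IsEnd G e w
    arcs-disjoint : ∀ e f → proj₁ e ≢ proj₁ f → ∀ p → OnPath (arc e) p → OnPath (arc f) p →
                    Σ (Fin (n G)) λ x → IsEnd G e x × IsEnd G f x × (p ≡ pos x)

Planar : Graph → Set
Planar G = PlaneDrawing G

Counterexample : Graph → Set
Counterexample G = Planar G × MaxDegAtMost 5 G × ¬ TwoDistanceColorable 16 G

MinimalCounterexample : Graph → Set
MinimalCounterexample G = Counterexample G
  × (∀ (H : Graph) → Counterexample H → size G ≤ size H)

MinDegAtLeast : ℕ → Graph → Set
MinDegAtLeast k G = ∀ u → k ≤ deg G u

{-# OPTIONS --safe #-}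
module Submission where

-- Suppose u has degree at most 2. Delete u and join its neighbours by an edge drawn along the two
-- edges through u, so the resulting graph H is still planar. No degree grows and no edge is gained,
-- so H is smaller with maximum degree at most 5. Distances among the remaining vertices do not grow,
-- hence a 2-distance 16-colouring of H is proper on G away from u, and u sees at most
-- 2 · (1 + 5) = 12 colours within distance 2, so it extends to G. Thus H is a smaller counterexample.

open import Defs renaming (sym to adj-sym; irrefl to adj-irrefl)
open import Data.Nat as ℕ using (ℕ; zero; suc; _+_; _*_; _≤_; _<_; z≤n; s≤s; z<s; _<ᵇ_)
import Data.Nat.Properties as ℕ
open import Data.Nat.ListAction as List using ()
open import Data.Fin as Fin using (Fin; zero; suc; toℕ; inject₁; fromℕ; _↑ˡ_; _↑ʳ_; opposite; punchIn; punchOut)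
import Data.Fin.Properties as Fin
open import Data.Rational as ℚ using (ℚ; 0ℚ; 1ℚ)
import Data.Rational.Properties as ℚ
open import Data.Rational.Solver using (module +-*-Solver)
open import Data.Bool using (Bool; true; false; T; if_then_else_; _∧_; _∨_; not)
import Data.Bool.Properties as Bool
open import Data.List using (List; []; _∷_; length; map; allFin; tabulate; filterᵇ; concatMap; lookup)
import Data.List.Properties as List
open import Data.List.Membership.Propositional using (_∈_; _∉_)
open import Data.List.Membership.Propositional.Properties using (∈-filter⁺; ∈-allFin; ∈-map⁺; ∈-concat⁺′)
import Data.List.Membership.DecPropositional as DecMembership
open import Data.List.Relation.Unary.Any as Any using (here; there)
open import Data.List.Relation.Unary.Any.Properties as Any using ()
open import Data.Product using (Σ; ∃; _×_; _,_; proj₁; proj₂)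
open import Data.Product.Properties using (≡-dec)
open import Data.Sum as Sum using (_⊎_; inj₁; inj₂)
open import Data.Unit using (tt)
open import Data.Vec.Functional using (_++_; updateAt; insertAt)
open import Data.Vec.Functional.Properties using (lookup-++ˡ; lookup-++ʳ; updateAt-updates; updateAt-minimal; insertAt-punchIn)
open import Function using (_∘_; id; const)
open import Relation.Nullary using (Dec; does; yes; no; ¬_; contradiction)
open import Relation.Nullary.Decidable using (from-yes; T?; dec-true; dec-false)
open import Relation.Unary using (_⊆_; _∪_)
open import Relation.Binary.PropositionalEquality
open import Algebra.Bundles using (CommutativeMonoid)
open import Algebra.Properties.CommutativeSemigroup ℕ.+-commutativeSemigroup using ()
  renaming (x∙yz≈y∙xz to x+[y+z]≡y+[x+z])
open import Algebra.Properties.CommutativeSemigroup (CommutativeMonoid.commutativeSemigroup Bool.∧-commutativeMonoid) using ()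
  renaming (x∙yz≈y∙xz to x∧[y∧z]≡y∧[x∧z])
open import Algebra.Properties.Semiring.Sum ℕ.+-*-semiring using (sum; sum-cong-≗; ∑-distrib-+; sum-remove; sum-replicate-zero)

-- Segments and polygonal arcs

open +-*-Solver using (solve; _:=_; _:+_; _:*_; _:-_; con)

onSeg-start : ∀ a b → OnSeg a a b
onSeg-start a b = 0ℚ , ℚ.≤-refl , from-yes (0ℚ ℚ.≤? 1ℚ) , at0 (proj₁ a) (proj₁ b) , at0 (proj₂ a) (proj₂ b)
  where
  at0 : ∀ a b → a ≡ a ℚ.+ 0ℚ ℚ.* (b ℚ.- a)
  at0 = solve 2 (λ a b → a := a :+ con 0ℚ :* (b :- a)) refl

onSeg-swap : ∀ {p} a b → OnSeg p a b → OnSeg p b a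
onSeg-swap a b (t , 0≤t , t≤1 , eq₁ , eq₂) =
  1ℚ ℚ.- t , ℚ.+-monoʳ-≤ 1ℚ (ℚ.neg-antimono-≤ t≤1) , ℚ.+-monoʳ-≤ 1ℚ (ℚ.neg-antimono-≤ 0≤t) ,
  trans eq₁ (swapped (proj₁ a) (proj₁ b) t) , trans eq₂ (swapped (proj₂ a) (proj₂ b) t)
  where
  swapped : ∀ a b t → a ℚ.+ t ℚ.* (b ℚ.- a) ≡ b ℚ.+ (1ℚ ℚ.- t) ℚ.* (a ℚ.- b)
  swapped = solve 3 (λ a b t → a :+ t :* (b :- a) := b :+ (con 1ℚ :- t) :* (a :- b)) refl

onSeg-end : ∀ a b → OnSeg b a b
onSeg-end a b = onSeg-swap b a (onSeg-start b a)

_≟ᴾ_ : (p q : Pt) → Dec (p ≡ q)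
_≟ᴾ_ = ≡-dec ℚ._≟_ ℚ._≟_

polyPath : (l : ℕ) → (Fin (suc (suc l)) → Pt) → PolyPath
polyPath l f = record { len = l ; pt = f }

FirstProper : PolyPath → Set
FirstProper P = start P ≢ pt P (suc zero)

LastProper : PolyPath → Set
LastProper P = pt P (inject₁ (fromℕ (len P))) ≢ end P

start-onSegment⇒zero : ∀ P → IsArc P → FirstProper P → ∀ i → OnSegment P i (start P) → i ≡ zero
start-onSegment⇒zero P arc first zero _ = refl
start-onSegment⇒zero P arc first (suc i) onᵢ =
  contradiction (proj₂ (arc zero (suc i) (s≤s z≤n) (start P) (onSeg-start (start P) (pt P (suc zero))) onᵢ)) first

end-onSegment⇒last : ∀ P → IsArc P → LastProper P → ∀ i → OnSegment P i (end P) → i ≡ fromℕ (len P)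
end-onSegment⇒last P arc last i onᵢ with i Fin.≟ fromℕ (len P)
... | yes i≡l = i≡l
... | no i≢l = contradiction (sym (trans end≡ (cong (pt P) suc-i≡l))) last
  where
  i<l : toℕ i ℕ.< toℕ (fromℕ (len P))
  i<l = ℕ.≤∧≢⇒< (Fin.≤fromℕ i) (i≢l ∘ Fin.toℕ-injective)
  consecutive : toℕ (fromℕ (len P)) ≡ suc (toℕ i) × end P ≡ pt P (suc i)
  consecutive = arc i (fromℕ (len P)) i<l (end P) onᵢ (onSeg-end (pt P (inject₁ (fromℕ (len P)))) (end P))
  end≡ : end P ≡ pt P (suc i)
  end≡ = proj₂ consecutive
  suc-i≡l : suc i ≡ inject₁ (fromℕ (len P))
  suc-i≡l = Fin.toℕ-injective (trans (sym (proj₁ consecutive)) (sym (Fin.toℕ-inject₁ _)))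

record Arc (x y : Pt) (S : Pt → Set) : Set where
  field
    path   : PolyPath
    isArc  : IsArc path
    start≡ : start path ≡ x
    end≡   : end path ≡ y
    inside : OnPath path ⊆ S
open Arc public

weakenArc : ∀ {x y S T} → S ⊆ T → Arc x y S → Arc x y T
weakenArc S⊆T A = record
  { path = path A ; isArc = isArc A ; start≡ = start≡ A ; end≡ = end≡ A ; inside = S⊆T ∘ inside A }

-- Concatenating arcs needs non-degenerate end segments: a degenerate last segment of the first arc
-- would put the junction also on a segment that is not adjacent to the first segment of the second.
ProperArc : Pt → Pt → (Pt → Set) → Set
ProperArc x y S = Σ (Arc x y S) λ A → FirstProper (path A) × LastProper (path A)

reverse : PolyPath → PolyPath
reverse P = record { len = len P ; pt = pt P ∘ opposite }

opposite-inject₁ : ∀ {l} (i : Fin (suc l)) → opposite {suc (suc l)} (inject₁ i) ≡ suc (opposite i)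
opposite-inject₁ zero = refl
opposite-inject₁ {suc l} (suc i) = cong inject₁ (opposite-inject₁ i)

opposite-fromℕ : ∀ l → opposite (fromℕ l) ≡ zero
opposite-fromℕ zero = refl
opposite-fromℕ (suc l) = cong inject₁ (opposite-fromℕ l)

toℕ-opposite+toℕ : ∀ {l} (i : Fin (suc l)) → toℕ (opposite i) + toℕ i ≡ l
toℕ-opposite+toℕ i = trans (cong (_+ toℕ i) (Fin.opposite-prop i)) (ℕ.m∸n+n≡m (Fin.toℕ≤pred[n] i))

end-reverse : ∀ P → end (reverse P) ≡ start P
end-reverse P = cong (pt P) (opposite-fromℕ (suc (len P)))

onSegment-reverse : ∀ P i {p} → OnSegment (reverse P) i p → OnSegment P (opposite i) p
onSegment-reverse P i {p} onᵢ =
  onSeg-swap (pt P (suc (opposite i))) (pt P (inject₁ (opposite i)))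
    (subst (λ k → OnSeg p (pt P k) (pt P (inject₁ (opposite i)))) (opposite-inject₁ i) onᵢ)

onPath-reverse : ∀ P → OnPath (reverse P) ⊆ OnPath P
onPath-reverse P (i , onᵢ) = opposite i , onSegment-reverse P i onᵢ

isArc-reverse : ∀ P → IsArc P → IsArc (reverse P)
isArc-reverse P arc i j i<j p onᵢ onⱼ = j≡1+i , trans p≡ (cong (pt P) 1+oj≡oi)
  where
  sums : toℕ (opposite i) + toℕ i ≡ toℕ (opposite j) + toℕ j
  sums = trans (toℕ-opposite+toℕ i) (sym (toℕ-opposite+toℕ j))
  oj<oi : toℕ (opposite j) ℕ.< toℕ (opposite i)
  oj<oi = ℕ.+-cancelʳ-< _ _ _ (subst (toℕ (opposite j) + toℕ i ℕ.<_) (sym sums) (ℕ.+-monoʳ-< (toℕ (opposite j)) i<j))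
  consecutive : toℕ (opposite i) ≡ suc (toℕ (opposite j)) × p ≡ pt P (suc (opposite j))
  consecutive = arc (opposite j) (opposite i) oj<oi p (onSegment-reverse P j onⱼ) (onSegment-reverse P i onᵢ)
  p≡ : p ≡ pt P (suc (opposite j))
  p≡ = proj₂ consecutive
  j≡1+i : toℕ j ≡ suc (toℕ i)
  j≡1+i = ℕ.+-cancelˡ-≡ (toℕ (opposite j)) _ _
            (trans (sym sums) (trans (cong (_+ toℕ i) (proj₁ consecutive)) (sym (ℕ.+-suc _ _))))
  1+oj≡oi : suc (opposite j) ≡ inject₁ (opposite i)
  1+oj≡oi = Fin.toℕ-injective (trans (sym (proj₁ consecutive)) (sym (Fin.toℕ-inject₁ (opposite i))))

reverseArc : ∀ {x y S} → Arc x y S → Arc y x S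
reverseArc A = record
  { path = reverse (path A)
  ; isArc = isArc-reverse (path A) (isArc A)
  ; start≡ = end≡ A
  ; end≡ = trans (end-reverse (path A)) (start≡ A)
  ; inside = inside A ∘ onPath-reverse (path A) }

isArc-init : ∀ {l} {f : Fin (suc (suc (suc l))) → Pt} → IsArc (polyPath (suc l) f) → IsArc (polyPath l (f ∘ inject₁))
isArc-init arc i j i<j p onᵢ onⱼ
  with arc (inject₁ i) (inject₁ j) (subst₂ ℕ._<_ (sym (Fin.toℕ-inject₁ i)) (sym (Fin.toℕ-inject₁ j)) i<j) p onᵢ onⱼ
... | j≡1+i , p≡ = trans (sym (Fin.toℕ-inject₁ j)) (trans j≡1+i (cong suc (Fin.toℕ-inject₁ i))) , p≡

isArc-tail : ∀ {l} {f : Fin (suc (suc (suc l))) → Pt} → IsArc (polyPath (suc l) f) → IsArc (polyPath l (f ∘ suc))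
isArc-tail arc i j i<j p onᵢ onⱼ with arc (suc i) (suc j) (s≤s i<j) p onᵢ onⱼ
... | j≡1+i , p≡ = ℕ.suc-injective j≡1+i , p≡

trimEnd : ∀ {x y S} l (f : Fin (suc (suc l)) → Pt) → IsArc (polyPath l f) → f zero ≡ x → f (fromℕ (suc l)) ≡ y →
          OnPath (polyPath l f) ⊆ S → x ≢ y → Σ (Arc x y S) (LastProper ∘ path)
trimEnd l f arc f₀≡x fₗ≡y sub x≢y with f (inject₁ (fromℕ l)) ≟ᴾ f (fromℕ (suc l))
... | no last = record { path = polyPath l f ; isArc = arc ; start≡ = f₀≡x ; end≡ = fₗ≡y ; inside = sub } , last
trimEnd zero f arc f₀≡x fₗ≡y sub x≢y | yes degenerate =
  contradiction (trans (sym f₀≡x) (trans degenerate fₗ≡y)) x≢y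
trimEnd (suc l) f arc f₀≡x fₗ≡y sub x≢y | yes degenerate =
  trimEnd l (f ∘ inject₁) (isArc-init {f = f} arc) f₀≡x (trans degenerate fₗ≡y)
    (λ (i , onᵢ) → sub (inject₁ i , onᵢ)) x≢y

trimStart : ∀ {x y S} l (f : Fin (suc (suc l)) → Pt) → IsArc (polyPath l f) → f zero ≡ x → f (fromℕ (suc l)) ≡ y →
            OnPath (polyPath l f) ⊆ S → LastProper (polyPath l f) → x ≢ y → ProperArc x y S
trimStart l f arc f₀≡x fₗ≡y sub last x≢y with f zero ≟ᴾ f (suc zero)
... | no first = record { path = polyPath l f ; isArc = arc ; start≡ = f₀≡x ; end≡ = fₗ≡y ; inside = sub } , first , last
trimStart zero f arc f₀≡x fₗ≡y sub last x≢y | yes degenerate =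
  contradiction (trans (sym f₀≡x) (trans degenerate fₗ≡y)) x≢y
trimStart (suc l) f arc f₀≡x fₗ≡y sub last x≢y | yes degenerate =
  trimStart l (f ∘ suc) (isArc-tail {f = f} arc) (trans (sym degenerate) f₀≡x) fₗ≡y
    (λ (i , onᵢ) → sub (suc i , onᵢ)) last x≢y

properArc : ∀ {x y S} → Arc x y S → x ≢ y → ProperArc x y S
properArc A x≢y with trimEnd (len (path A)) (pt (path A)) (isArc A) (start≡ A) (end≡ A) (inside A) x≢y
... | B , last = trimStart (len (path B)) (pt (path B)) (isArc B) (start≡ B) (end≡ B) (inside B) last x≢y

inject₁-↑ˡ : ∀ {m} (i : Fin m) n → inject₁ (i ↑ˡ n) ≡ inject₁ i ↑ˡ n
inject₁-↑ˡ zero n = refl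
inject₁-↑ˡ (suc i) n = cong suc (inject₁-↑ˡ i n)

inject₁-↑ʳ-zero : ∀ m {n} → inject₁ (m ↑ʳ zero {n}) ≡ fromℕ m ↑ˡ suc n
inject₁-↑ʳ-zero zero = refl
inject₁-↑ʳ-zero (suc m) = cong suc (inject₁-↑ʳ-zero m)

inject₁-↑ʳ-suc : ∀ m {n} (j : Fin n) → inject₁ (m ↑ʳ suc j) ≡ suc m ↑ʳ inject₁ j
inject₁-↑ʳ-suc zero j = refl
inject₁-↑ʳ-suc (suc m) j = cong suc (inject₁-↑ʳ-suc m j)

fromℕ-↑ʳ : ∀ m n → fromℕ (m + suc n) ≡ suc m ↑ʳ fromℕ n
fromℕ-↑ʳ zero n = refl
fromℕ-↑ʳ (suc m) n = cong suc (fromℕ-↑ʳ m n)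

data SplitView (m n : ℕ) : Fin (m + n) → Set where
  left  : (i : Fin m) → SplitView m n (i ↑ˡ n)
  right : (j : Fin n) → SplitView m n (m ↑ʳ j)

splitView : ∀ m n (k : Fin (m + n)) → SplitView m n k
splitView zero n k = right k
splitView (suc m) n zero = left zero
splitView (suc m) n (suc k) with splitView m n k
... | left i = left (suc i)
... | right j = right j

_++ᴾ_ : PolyPath → PolyPath → PolyPath
P ++ᴾ Q = record { len = len P + suc (len Q) ; pt = pt P ++ (pt Q ∘ suc) }

module _ (P Q : PolyPath) (junction : end P ≡ start Q) where

  private
    a = len P
    b = len Q
    C = P ++ᴾ Q

  onSegment-++ˡ : ∀ i {p} → OnSegment C (i ↑ˡ suc b) p → OnSegment P i p
  onSegment-++ˡ i {p} = subst₂ (OnSeg p)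
    (trans (cong (pt C) (inject₁-↑ˡ i (suc b))) (lookup-++ˡ (pt P) _ (inject₁ i))) (lookup-++ˡ (pt P) _ (suc i))

  pt-++-inject₁-↑ʳ : ∀ j → pt C (inject₁ (suc a ↑ʳ j)) ≡ pt Q (inject₁ j)
  pt-++-inject₁-↑ʳ zero = trans (cong (pt C) (inject₁-↑ʳ-zero (suc a))) (trans (lookup-++ˡ (pt P) _ _) junction)
  pt-++-inject₁-↑ʳ (suc j) = trans (cong (pt C) (inject₁-↑ʳ-suc (suc a) j)) (lookup-++ʳ (pt P) _ (inject₁ j))

  onSegment-++ʳ : ∀ j {p} → OnSegment C (suc a ↑ʳ j) p → OnSegment Q j p
  onSegment-++ʳ j {p} = subst₂ (OnSeg p) (pt-++-inject₁-↑ʳ j) (lookup-++ʳ (pt P) _ j)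

  onPath-++ : OnPath C ⊆ OnPath P ∪ OnPath Q
  onPath-++ (k , onₖ) with splitView (suc a) (suc b) k
  ... | left i = inj₁ (i , onSegment-++ˡ i onₖ)
  ... | right j = inj₂ (j , onSegment-++ʳ j onₖ)

  end-++ : end C ≡ end Q
  end-++ = trans (cong (pt C) (fromℕ-↑ʳ (suc a) b)) (lookup-++ʳ (pt P) _ (fromℕ b))

  isArc-++ : IsArc P → IsArc Q → LastProper P → FirstProper Q →
             (∀ {p} → OnPath P p → OnPath Q p → p ≡ end P) → IsArc C
  isArc-++ arcP arcQ lastP firstQ meet k l k<l p onₖ onₗ
    with splitView (suc a) (suc b) k | splitView (suc a) (suc b) l
  ... | left i | left j with arcP i j (subst₂ ℕ._<_ (Fin.toℕ-↑ˡ i _) (Fin.toℕ-↑ˡ j _) k<l) p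
                               (onSegment-++ˡ i onₖ) (onSegment-++ˡ j onₗ)
  ...   | j≡1+i , p≡ = trans (Fin.toℕ-↑ˡ j _) (trans j≡1+i (cong suc (sym (Fin.toℕ-↑ˡ i _)))) ,
                       trans p≡ (sym (lookup-++ˡ (pt P) _ (suc i)))
  isArc-++ arcP arcQ lastP firstQ meet k l k<l p onₖ onₗ | right i | right j
    with arcQ i j (ℕ.+-cancelˡ-< (suc a) _ _ (subst₂ ℕ._<_ (Fin.toℕ-↑ʳ (suc a) i) (Fin.toℕ-↑ʳ (suc a) j) k<l)) p
              (onSegment-++ʳ i onₖ) (onSegment-++ʳ j onₗ)
  ... | j≡1+i , p≡ = trans (Fin.toℕ-↑ʳ (suc a) j) (trans (cong (suc a +_) j≡1+i)
                       (trans (ℕ.+-suc (suc a) (toℕ i)) (cong suc (sym (Fin.toℕ-↑ʳ (suc a) i))))) ,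
                     trans p≡ (sym (lookup-++ʳ (pt P) _ i))
  isArc-++ arcP arcQ lastP firstQ meet k l k<l p onₖ onₗ | right i | left j =
    contradiction (subst₂ ℕ._<_ (Fin.toℕ-↑ʳ (suc a) i) (Fin.toℕ-↑ˡ j _) k<l)
                  (ℕ.≤⇒≯ (ℕ.≤-trans (ℕ.<⇒≤ (Fin.toℕ<n j)) (ℕ.m≤m+n (suc a) (toℕ i))))
  isArc-++ arcP arcQ lastP firstQ meet k l k<l p onₖ onₗ | left i | right j
    with meet (i , onSegment-++ˡ i onₖ) (j , onSegment-++ʳ j onₗ)
  ... | refl with end-onSegment⇒last P arcP lastP i (onSegment-++ˡ i onₖ)
                | start-onSegment⇒zero Q arcQ firstQ j (subst (OnSegment Q j) junction (onSegment-++ʳ j onₗ))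
  ... | refl | refl = trans (Fin.toℕ-↑ʳ (suc a) zero) (cong suc (trans (ℕ.+-identityʳ a)
                        (sym (trans (Fin.toℕ-↑ˡ (fromℕ a) _) (Fin.toℕ-fromℕ a))))) ,
                      sym (lookup-++ˡ (pt P) _ (fromℕ (suc a)))

concatArc : ∀ {x y z S T} → ProperArc x y S → ProperArc y z T → (∀ {p} → S p → T p → p ≡ y) → Arc x z (S ∪ T)
concatArc (A , _ , lastA) (B , firstB , _) meet = record
  { path = path A ++ᴾ path B
  ; isArc = isArc-++ (path A) (path B) junction (isArc A) (isArc B) lastA firstB
              (λ onA onB → trans (meet (inside A onA) (inside B onB)) (sym (end≡ A)))
  ; start≡ = start≡ A
  ; end≡ = trans (end-++ (path A) (path B) junction) (end≡ B)
  ; inside = Sum.map (inside A) (inside B) ∘ onPath-++ (path A) (path B) junction }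
  where
  junction = trans (end≡ A) (sym (start≡ B))

-- Finite sums and counting

⟦_⟧ : Bool → ℕ
⟦ b ⟧ = if b then 1 else 0

⟦∨⟧≤ : ∀ x y → ⟦ x ∨ y ⟧ ≤ ⟦ x ⟧ + ⟦ y ⟧
⟦∨⟧≤ false y = ℕ.≤-refl
⟦∨⟧≤ true false = ℕ.≤-refl
⟦∨⟧≤ true true = s≤s z≤n

⟦∧∨⟧≤ : ∀ c x y → ⟦ c ∧ (x ∨ y) ⟧ ≤ ⟦ c ∧ x ⟧ + ⟦ y ⟧
⟦∧∨⟧≤ false x y = z≤n
⟦∧∨⟧≤ true x y = ⟦∨⟧≤ x y

⟦⟧≤⟦∧⟧+⟦∧⟧ : ∀ c₁ c₂ x → c₁ ∨ c₂ ≡ true → ⟦ x ⟧ ≤ ⟦ c₁ ∧ x ⟧ + ⟦ c₂ ∧ x ⟧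
⟦⟧≤⟦∧⟧+⟦∧⟧ c₁ c₂ false _ = z≤n
⟦⟧≤⟦∧⟧+⟦∧⟧ true c₂ true _ = s≤s z≤n
⟦⟧≤⟦∧⟧+⟦∧⟧ false true true _ = s≤s z≤n

⟦∧not⟧ : ∀ x e → ⟦ x ∧ not e ⟧ ≡ (if e then 0 else ⟦ x ⟧)
⟦∧not⟧ false false = refl
⟦∧not⟧ false true = refl
⟦∧not⟧ true false = refl
⟦∧not⟧ true true = refl

sum-allFin : ∀ {n} (f : Fin n → ℕ) → List.sum (map f (allFin n)) ≡ sum f
sum-allFin {n} f = trans (cong List.sum (List.map-tabulate id f)) (sum-tabulate f)
  where
  sum-tabulate : ∀ {n} (f : Fin n → ℕ) → List.sum (tabulate f) ≡ sum f
  sum-tabulate {zero} f = refl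
  sum-tabulate {suc n} f = cong (f zero +_) (sum-tabulate (f ∘ suc))

sum-mono-≤ : ∀ {n} {f g : Fin n → ℕ} → (∀ i → f i ≤ g i) → sum f ≤ sum g
sum-mono-≤ {zero} f≤g = z≤n
sum-mono-≤ {suc n} f≤g = ℕ.+-mono-≤ (f≤g zero) (sum-mono-≤ (f≤g ∘ suc))

sum-pick : ∀ {n} (i : Fin n) (f : Fin n → ℕ) → sum f ≡ f i + sum (λ j → if does (i Fin.≟ j) then 0 else f j)
sum-pick zero f = refl
sum-pick (suc i) f = trans (cong (f zero +_) (sum-pick i (f ∘ suc))) (x+[y+z]≡y+[x+z] (f zero) (f (suc i)) _)

count : ∀ {n} → (Fin n → Bool) → ℕ
count p = sum (⟦_⟧ ∘ p)

erase : ∀ {n} → (Fin n → Bool) → Fin n → Fin n → Bool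
erase p i j = p j ∧ not (does (i Fin.≟ j))

erase-true : ∀ {n} (p : Fin n → Bool) {i j} → i ≢ j → p j ≡ true → erase p i j ≡ true
erase-true p {i} {j} i≢j pⱼ rewrite dec-false (i Fin.≟ j) i≢j = cong (_∧ true) pⱼ

count-remove : ∀ {n} (p : Fin n → Bool) {i} → p i ≡ true → count p ≡ suc (count (erase p i))
count-remove p {i} pᵢ = trans (sum-pick i (⟦_⟧ ∘ p))
  (cong₂ _+_ (cong ⟦_⟧ pᵢ) (sum-cong-≗ (λ j → sym (⟦∧not⟧ (p j) (does (i Fin.≟ j))))))

count≤2⇒≡⊎≡ : ∀ {n} (p : Fin n → Bool) {i j k} → count p ≤ 2 → i ≢ j →
              p i ≡ true → p j ≡ true → p k ≡ true → k ≡ i ⊎ k ≡ j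
count≤2⇒≡⊎≡ p {i} {j} {k} count≤2 i≢j pᵢ pⱼ pₖ with k Fin.≟ i | k Fin.≟ j
... | yes k≡i | _ = inj₁ k≡i
... | no _ | yes k≡j = inj₂ k≡j
... | no k≢i | no k≢j = contradiction count≤2 (ℕ.<⇒≱ 3≤count)
  where
  3≤count : 2 < count p
  3≤count rewrite count-remove p pᵢ | count-remove (erase p i) (erase-true p i≢j pⱼ)
                | count-remove (erase (erase p i) j) (erase-true (erase p i) (k≢j ∘ sym) (erase-true p (k≢i ∘ sym) pₖ))
    = s≤s (s≤s (s≤s z≤n))

does-≟-sym : ∀ {n} (i j : Fin n) → does (i Fin.≟ j) ≡ does (j Fin.≟ i)
does-≟-sym i j with i Fin.≟ j
... | yes refl = sym (dec-true (i Fin.≟ i) refl)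
... | no i≢j = sym (dec-false (j Fin.≟ i) (i≢j ∘ sym))

<ᵇ-irrefl : ∀ x → (x <ᵇ x) ≡ false
<ᵇ-irrefl zero = refl
<ᵇ-irrefl (suc x) = <ᵇ-irrefl x

<ᵇ-connex : ∀ {n} {x y : Fin n} → x ≢ y → (toℕ x <ᵇ toℕ y) ∨ (toℕ y <ᵇ toℕ x) ≡ true
<ᵇ-connex {x = zero} {zero} x≢y = contradiction refl x≢y
<ᵇ-connex {x = zero} {suc y} _ = refl
<ᵇ-connex {x = suc x} {zero} _ = refl
<ᵇ-connex {x = suc x} {suc y} x≢y = <ᵇ-connex (x≢y ∘ cong suc)

<ᵇ-punchIn : ∀ {n} (p : Fin (suc n)) (i j : Fin n) → (toℕ (punchIn p i) <ᵇ toℕ (punchIn p j)) ≡ (toℕ i <ᵇ toℕ j)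
<ᵇ-punchIn zero i j = refl
<ᵇ-punchIn (suc p) zero zero = refl
<ᵇ-punchIn (suc p) zero (suc j) = refl
<ᵇ-punchIn (suc p) (suc i) zero = refl
<ᵇ-punchIn (suc p) (suc i) (suc j) = <ᵇ-punchIn p i j

edgeᵇ : ∀ {n} → (Fin n → Fin n → Bool) → Fin n → Fin n → Bool
edgeᵇ r x y = (toℕ x <ᵇ toℕ y) ∧ r x y

numEdges-sum : ∀ G → numEdges G ≡ sum (λ x → sum (λ y → ⟦ edgeᵇ (adj G) x y ⟧))
numEdges-sum G = trans (sum-allFin {n G} _) (sum-cong-≗ (λ x → sum-allFin (λ y → ⟦ edgeᵇ (adj G) x y ⟧)))

-- Neighbourhoods and 2-distance colourings

withinDist2-sym : ∀ G {x y} → WithinDist2 G x y → WithinDist2 G y x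
withinDist2-sym G {x} {y} (inj₁ x~y) = inj₁ (trans (adj-sym G y x) x~y)
withinDist2-sym G {x} {y} (inj₂ (w , x~w , w~y)) = inj₂ (w , trans (adj-sym G y w) w~y , trans (adj-sym G w x) x~w)

deg-sum : ∀ G v → deg G v ≡ sum (λ w → ⟦ adj G v w ⟧)
deg-sum G v = sum-allFin (λ w → ⟦ adj G v w ⟧)

data Ends (G : Graph) (e : Edge G) (x y : Fin (n G)) : Set where
  forward  : proj₁ e ≡ (x , y) → Ends G e x y
  backward : proj₁ e ≡ (y , x) → Ends G e x y

ends-of : ∀ {G e x y w} → Ends G e x y → IsEnd G e w → w ≡ x ⊎ w ≡ y
ends-of (forward refl) w-end = w-end
ends-of (backward refl) (inj₁ w≡y) = inj₂ w≡y
ends-of (backward refl) (inj₂ w≡x) = inj₁ w≡x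

isEnd₁ : ∀ {G e x y} → Ends G e x y → IsEnd G e x
isEnd₁ (forward refl) = inj₁ refl
isEnd₁ (backward refl) = inj₂ refl

isEnd₂ : ∀ {G e x y} → Ends G e x y → IsEnd G e y
isEnd₂ (forward refl) = inj₂ refl
isEnd₂ (backward refl) = inj₁ refl

isEnd-≡ : ∀ {G} {e f : Edge G} {x} → proj₁ e ≡ proj₁ f → IsEnd G e x → IsEnd G f x
isEnd-≡ refl x-end = x-end

neighbours : (G : Graph) → Fin (n G) → List (Fin (n G))
neighbours G v = filterᵇ (adj G v) (allFin (n G))

length-filterᵇ : ∀ {A : Set} (p : A → Bool) xs → length (filterᵇ p xs) ≡ List.sum (map (⟦_⟧ ∘ p) xs)
length-filterᵇ p [] = refl
length-filterᵇ p (x ∷ xs) with p x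
... | true = cong suc (length-filterᵇ p xs)
... | false = length-filterᵇ p xs

length-neighbours : ∀ G v → length (neighbours G v) ≡ deg G v
length-neighbours G v = length-filterᵇ (adj G v) (allFin (n G))

∈-neighbours : ∀ G {v w} → Adj G v w → w ∈ neighbours G v
∈-neighbours G {v} {w} v~w = ∈-filter⁺ (T? ∘ adj G v) (∈-allFin w) (subst T (sym v~w) tt)

length-concatMap-≤ : ∀ {A B : Set} (f : A → List B) {b} → (∀ x → length (f x) ≤ b) →
                     ∀ xs → length (concatMap f xs) ≤ length xs * b
length-concatMap-≤ f bound [] = z≤n
length-concatMap-≤ f bound (x ∷ xs) =
  subst (_≤ _) (sym (List.length-++ (f x))) (ℕ.+-mono-≤ (bound x) (length-concatMap-≤ f bound xs))

length<⇒∃∉ : ∀ {k} (xs : List (Fin k)) → length xs < k → ∃ λ κ → κ ∉ xs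
length<⇒∃∉ {k} xs short = Fin.¬∀⟶∃¬ k (_∈ xs) (_∈? xs) notAll
  where
  open DecMembership (Fin._≟_ {k}) using (_∈?_)
  notAll : ¬ (∀ κ → κ ∈ xs)
  notAll all with Fin.pigeonhole short (Any.index ∘ all)
  ... | i , j , i<j , same = Fin.<-irrefl (trans (Any.lookup-index (all i)) (trans (cong (lookup xs) same)
                                (sym (Any.lookup-index (all j))))) i<j

module _ {k : ℕ} (G : Graph) (c : Fin (n G) → Fin k) where

  colours-near : Fin (n G) → List (Fin k)
  colours-near u = concatMap (λ v → c v ∷ map c (neighbours G v)) (neighbours G u)

  length-colours-near : ∀ {Δ} → MaxDegAtMost Δ G → ∀ u → length (colours-near u) ≤ deg G u * suc Δ
  length-colours-near {Δ} maxDeg u = subst (λ d → length (colours-near u) ≤ d * suc Δ) (length-neighbours G u)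
    (length-concatMap-≤ _ (λ v → s≤s (subst (_≤ Δ) (sym (length-map-neighbours v)) (maxDeg v))) (neighbours G u))
    where
    length-map-neighbours : ∀ v → length (map c (neighbours G v)) ≡ deg G v
    length-map-neighbours v = trans (List.length-map c (neighbours G v)) (length-neighbours G v)

  ∈-colours-near : ∀ {u x} → WithinDist2 G u x → c x ∈ colours-near u
  ∈-colours-near (inj₁ u~x) = ∈-concat⁺′ (here refl) (∈-map⁺ _ (∈-neighbours G u~x))
  ∈-colours-near (inj₂ (w , u~w , w~x)) =
    ∈-concat⁺′ (there (∈-map⁺ c (∈-neighbours G w~x))) (∈-map⁺ _ (∈-neighbours G u~w))

  extend-colouring : ∀ {Δ} → MaxDegAtMost Δ G → ∀ u → deg G u * suc Δ < k →
                     (∀ x y → x ≢ u → y ≢ u → x ≢ y → WithinDist2 G x y → c x ≢ c y) → TwoDistanceColorable k G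
  extend-colouring maxDeg u few proper
    with length<⇒∃∉ (colours-near u) (ℕ.≤-<-trans (length-colours-near maxDeg u) few)
  ... | κ , κ-unused = c′ , proper′
    where
    c′ : Fin (n G) → Fin k
    c′ = updateAt c u (const κ)
    κ≢near : ∀ {y} → WithinDist2 G u y → κ ≢ c y
    κ≢near near κ≡cy = κ-unused (subst (_∈ colours-near u) (sym κ≡cy) (∈-colours-near near))
    c′u≡κ : c′ u ≡ κ
    c′u≡κ = updateAt-updates u c
    proper′ : TwoDistanceColoring k G c′
    proper′ x y x≢y near with x Fin.≟ u | y Fin.≟ u
    ... | yes refl | yes refl = contradiction refl x≢y
    ... | yes refl | no y≢u = λ eq → κ≢near near (trans (sym c′u≡κ) (trans eq (updateAt-minimal y u c y≢u)))
    ... | no x≢u | yes refl =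
      λ eq → κ≢near (withinDist2-sym G near) (trans (sym c′u≡κ) (trans (sym eq) (updateAt-minimal x u c x≢u)))
    ... | no x≢u | no y≢u = λ eq → proper x y x≢u y≢u x≢y near
                              (trans (sym (updateAt-minimal x u c x≢u)) (trans eq (updateAt-minimal y u c y≢u)))

-- Deleting a vertex of degree at most two

-- H is G with u deleted and any two neighbours of u joined; for deg u = 2 this smooths u away.
module Smoothing {m : ℕ} (a : Fin (suc m) → Fin (suc m) → Bool)
  (a-sym : ∀ x y → a x y ≡ a y x) (a-irrefl : ∀ x → a x x ≡ false) (u : Fin (suc m)) where

  G : Graph
  G = record { n = suc m ; adj = a ; sym = a-sym ; irrefl = a-irrefl }

  ι : Fin m → Fin (suc m)
  ι = punchIn u

  data VertexView : Fin (suc m) → Set where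
    centre : VertexView u
    other  : ∀ i → VertexView (ι i)

  vertexView : ∀ x → VertexView x
  vertexView x with u Fin.≟ x
  ... | yes refl = centre
  ... | no u≢x = subst VertexView (Fin.punchIn-punchOut u≢x) (other (punchOut u≢x))

  ι≢u : ∀ i → ι i ≢ u
  ι≢u = Fin.punchInᵢ≢i u

  ι-injective : ∀ {i j} → ι i ≡ ι j → i ≡ j
  ι-injective = Fin.punchIn-injective u _ _

  adjᵤ : Fin m → Bool
  adjᵤ j = a (ι j) u

  joined : Fin m → Fin m → Bool
  joined i j = adjᵤ i ∧ erase adjᵤ i j

  adjH : Fin m → Fin m → Bool
  adjH i j = a (ι i) (ι j) ∨ joined i j

  adjH-sym : ∀ i j → adjH i j ≡ adjH j i
  adjH-sym i j = cong₂ _∨_ (a-sym (ι i) (ι j))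
    (trans (x∧[y∧z]≡y∧[x∧z] (adjᵤ i) (adjᵤ j) _) (cong (λ b → adjᵤ j ∧ (adjᵤ i ∧ not b)) (does-≟-sym i j)))

  adjH-irrefl : ∀ i → adjH i i ≡ false
  adjH-irrefl i rewrite a-irrefl (ι i) | dec-true (i Fin.≟ i) refl | Bool.∧-zeroʳ (adjᵤ i) = Bool.∧-zeroʳ (adjᵤ i)

  H : Graph
  H = record { n = m ; adj = adjH ; sym = adjH-sym ; irrefl = adjH-irrefl }

  adjH-old : ∀ {i j} → Adj G (ι i) (ι j) → Adj H i j
  adjH-old {i} {j} ιi~ιj = cong (_∨ joined i j) ιi~ιj

  adjH-joined : ∀ {i j} → i ≢ j → adjᵤ i ≡ true → adjᵤ j ≡ true → Adj H i j
  adjH-joined {i} {j} i≢j i~u j~u rewrite i~u | j~u with i Fin.≟ j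
  ... | yes i≡j = contradiction i≡j i≢j
  ... | no _ = Bool.∨-zeroʳ (a (ι i) (ι j))

  withinDist2-smoothed : ∀ {i j} → i ≢ j → WithinDist2 G (ι i) (ι j) → WithinDist2 H i j
  withinDist2-smoothed i≢j (inj₁ ιi~ιj) = inj₁ (adjH-old ιi~ιj)
  withinDist2-smoothed {i} {j} i≢j (inj₂ (w , ιi~w , w~ιj)) with vertexView w
  ... | centre = inj₁ (adjH-joined i≢j ιi~w (trans (a-sym (ι j) u) w~ιj))
  ... | other k = inj₂ (k , adjH-old ιi~w , adjH-old w~ιj)

  twoDistanceColorable-smoothed : ∀ {k Δ} → MaxDegAtMost Δ G → deg G u * suc Δ < suc k →
                                  TwoDistanceColorable (suc k) H → TwoDistanceColorable (suc k) G
  twoDistanceColorable-smoothed maxDeg few (c , proper) = extend-colouring G (insertAt c u zero) maxDeg u few lifted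
    where
    lifted : ∀ x y → x ≢ u → y ≢ u → x ≢ y → WithinDist2 G x y → insertAt c u zero x ≢ insertAt c u zero y
    lifted x y x≢u y≢u x≢y near with vertexView x | vertexView y
    ... | centre | _ = contradiction refl x≢u
    ... | other _ | centre = contradiction refl y≢u
    ... | other i | other j = λ eq → proper i j (x≢y ∘ cong ι) (withinDist2-smoothed (x≢y ∘ cong ι) near)
                                (trans (sym (insertAt-punchIn c u zero i)) (trans eq (insertAt-punchIn c u zero j)))

  deg-u : deg G u ≡ count adjᵤ
  deg-u = trans (deg-sum G u) (trans (sum-remove {i = u} (λ y → ⟦ a u y ⟧))
            (cong₂ _+_ (cong ⟦_⟧ (a-irrefl u)) (sum-cong-≗ (λ j → cong ⟦_⟧ (a-sym u (ι j))))))

  deg-ι : ∀ i → deg G (ι i) ≡ ⟦ adjᵤ i ⟧ + sum (λ j → ⟦ a (ι i) (ι j) ⟧)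
  deg-ι i = trans (deg-sum G (ι i)) (sum-remove {i = u} (λ y → ⟦ a (ι i) y ⟧))

  count-adjᵤ : ∀ {i} → adjᵤ i ≡ true → count adjᵤ ≡ suc (count (joined i))
  count-adjᵤ {i} i~u = trans (count-remove adjᵤ i~u)
    (cong suc (sum-cong-≗ (λ j → cong (λ b → ⟦ b ∧ erase adjᵤ i j ⟧) (sym i~u))))

  edgesAtU : ℕ
  edgesAtU = sum (λ j → ⟦ edgeᵇ a u (ι j) ⟧ + ⟦ edgeᵇ a (ι j) u ⟧)

  edgesAway : ℕ
  edgesAway = sum (λ i → sum (λ j → ⟦ edgeᵇ a (ι i) (ι j) ⟧))

  numEdges-G : numEdges G ≡ edgesAtU + edgesAway
  numEdges-G = begin
    numEdges G
      ≡⟨ numEdges-sum G ⟩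
    sum (λ x → sum (λ y → e x y))
      ≡⟨ sum-remove {i = u} (λ x → sum (e x)) ⟩
    sum (e u) + sum (λ i → sum (e (ι i)))
      ≡⟨ cong₂ _+_ (sum-remove {i = u} (e u)) (sum-cong-≗ (λ i → sum-remove {i = u} (e (ι i)))) ⟩
    (e u u + sum (λ j → e u (ι j))) + sum (λ i → e (ι i) u + sum (λ j → e (ι i) (ι j)))
      ≡⟨ cong₂ _+_ (cong (λ b → ⟦ b ∧ a u u ⟧ + sum (e u ∘ ι)) (<ᵇ-irrefl (toℕ u)))
                   (∑-distrib-+ (λ i → e (ι i) u) (λ i → sum (e (ι i) ∘ ι))) ⟩
    sum (λ j → e u (ι j)) + (sum (λ i → e (ι i) u) + edgesAway)
      ≡⟨ sym (ℕ.+-assoc (sum (e u ∘ ι)) _ edgesAway) ⟩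
    (sum (λ j → e u (ι j)) + sum (λ i → e (ι i) u)) + edgesAway
      ≡⟨ cong (_+ edgesAway) (sym (∑-distrib-+ (e u ∘ ι) (λ i → e (ι i) u))) ⟩
    edgesAtU + edgesAway ∎
    where
    open ≡-Reasoning
    e : Fin (suc m) → Fin (suc m) → ℕ
    e x y = ⟦ edgeᵇ a x y ⟧

  count-adjᵤ≤edgesAtU : count adjᵤ ≤ edgesAtU
  count-adjᵤ≤edgesAtU = sum-mono-≤ λ j →
    subst (λ b → ⟦ adjᵤ j ⟧ ≤ ⟦ (toℕ u <ᵇ toℕ (ι j)) ∧ b ⟧ + ⟦ edgeᵇ a (ι j) u ⟧) (a-sym (ι j) u)
      (⟦⟧≤⟦∧⟧+⟦∧⟧ (toℕ u <ᵇ toℕ (ι j)) (toℕ (ι j) <ᵇ toℕ u) (adjᵤ j) (<ᵇ-connex (ι≢u j ∘ sym)))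

  module _ (deg-u≤2 : deg G u ≤ 2) where

    count-adjᵤ≤2 : count adjᵤ ≤ 2
    count-adjᵤ≤2 = subst (_≤ 2) deg-u deg-u≤2

    count-joined≤ : ∀ i → count (joined i) ≤ ⟦ adjᵤ i ⟧
    count-joined≤ i = bound (adjᵤ i) refl
      where
      bound : ∀ b → adjᵤ i ≡ b → count (joined i) ≤ ⟦ b ⟧
      bound true i~u = ℕ.≤-pred (subst (_≤ 2) (count-adjᵤ i~u) count-adjᵤ≤2)
      bound false i≁u =
        ℕ.≤-reflexive (trans (sum-cong-≗ (λ j → cong (λ b → ⟦ b ∧ erase adjᵤ i j ⟧) i≁u)) (sum-replicate-zero m))

    maxDeg-smoothed : ∀ {Δ} → MaxDegAtMost Δ G → MaxDegAtMost Δ H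
    maxDeg-smoothed {Δ} maxDeg i = begin
      deg H i                                ≡⟨ deg-sum H i ⟩
      sum (λ j → ⟦ adjH i j ⟧)                ≤⟨ sum-mono-≤ (λ j → ⟦∨⟧≤ (a (ι i) (ι j)) (joined i j)) ⟩
      sum (λ j → old j + ⟦ joined i j ⟧)      ≡⟨ ∑-distrib-+ old (⟦_⟧ ∘ joined i) ⟩
      sum old + count (joined i)             ≤⟨ ℕ.+-monoʳ-≤ (sum old) (count-joined≤ i) ⟩
      sum old + ⟦ adjᵤ i ⟧                    ≡⟨ ℕ.+-comm (sum old) ⟦ adjᵤ i ⟧ ⟩
      ⟦ adjᵤ i ⟧ + sum old                    ≡⟨ deg-ι i ⟨
      deg G (ι i)                            ≤⟨ maxDeg (ι i) ⟩
      Δ                                      ∎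
      where
      open ℕ.≤-Reasoning
      old : Fin m → ℕ
      old j = ⟦ a (ι i) (ι j) ⟧

    numEdges-H : numEdges H ≤ edgesAway + count adjᵤ
    numEdges-H = begin
      numEdges H
        ≡⟨ numEdges-sum H ⟩
      sum (λ i → sum (λ j → ⟦ edgeᵇ adjH i j ⟧))
        ≤⟨ sum-mono-≤ (λ i → sum-mono-≤ (λ j → ⟦∧∨⟧≤ (toℕ i <ᵇ toℕ j) (a (ι i) (ι j)) (joined i j))) ⟩
      sum (λ i → sum (λ j → e′ i j + ⟦ joined i j ⟧))
        ≡⟨ sum-cong-≗ (λ i → ∑-distrib-+ (e′ i) (⟦_⟧ ∘ joined i)) ⟩
      sum (λ i → sum (e′ i) + count (joined i))
        ≡⟨ ∑-distrib-+ (sum ∘ e′) (count ∘ joined) ⟩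
      sum (sum ∘ e′) + sum (count ∘ joined)
        ≡⟨ cong (_+ sum (count ∘ joined)) (sum-cong-≗ (λ i → sum-cong-≗ (λ j →
             cong (λ b → ⟦ b ∧ a (ι i) (ι j) ⟧) (sym (<ᵇ-punchIn u i j))))) ⟩
      edgesAway + sum (count ∘ joined)
        ≤⟨ ℕ.+-monoʳ-≤ edgesAway (sum-mono-≤ count-joined≤) ⟩
      edgesAway + count adjᵤ ∎
      where
      open ℕ.≤-Reasoning
      e′ : Fin m → Fin m → ℕ
      e′ i j = ⟦ edgeᵇ (λ x y → a (ι x) (ι y)) i j ⟧

    size-smoothed : size H < size G
    size-smoothed = s≤s (ℕ.+-monoʳ-≤ m (begin
      numEdges H               ≤⟨ numEdges-H ⟩
      edgesAway + count adjᵤ   ≤⟨ ℕ.+-monoʳ-≤ edgesAway count-adjᵤ≤edgesAtU ⟩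
      edgesAway + edgesAtU     ≡⟨ ℕ.+-comm edgesAway edgesAtU ⟩
      edgesAtU + edgesAway     ≡⟨ numEdges-G ⟨
      numEdges G               ∎))
      where open ℕ.≤-Reasoning

    joined-unique : ∀ {i j k l} → toℕ i < toℕ j → toℕ k < toℕ l →
                    adjᵤ i ≡ true → adjᵤ j ≡ true → adjᵤ k ≡ true → adjᵤ l ≡ true → (i , j) ≡ (k , l)
    joined-unique {i} {j} i<j k<l i~u j~u k~u l~u
      with count≤2⇒≡⊎≡ adjᵤ count-adjᵤ≤2 (Fin.<⇒≢ i<j) i~u j~u k~u
         | count≤2⇒≡⊎≡ adjᵤ count-adjᵤ≤2 (Fin.<⇒≢ i<j) i~u j~u l~u
    ... | inj₁ refl | inj₁ refl = contradiction k<l (ℕ.<-irrefl refl)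
    ... | inj₁ refl | inj₂ refl = refl
    ... | inj₂ refl | inj₁ refl = contradiction k<l (ℕ.<-asym i<j)
    ... | inj₂ refl | inj₂ refl = contradiction k<l (ℕ.<-irrefl refl)

    module _ (D : PlaneDrawing G) where

      open PlaneDrawing D

      OnEdge : Fin (suc m) → Fin (suc m) → Pt → Set
      OnEdge x y p = Σ (Edge G) λ e → OnPath (arc e) p × Ends G e x y

      drawnArc : (e : Edge G) → Arc (pos (proj₁ (proj₁ e))) (pos (proj₂ (proj₁ e))) (OnPath (arc e))
      drawnArc e = record { path = arc e ; isArc = arc-isArc e ; start≡ = arc-start e ; end≡ = arc-end e ; inside = λ on → on }

      edgeArc : ∀ {x y} → x ≢ y → Adj G x y → ProperArc (pos x) (pos y) (OnEdge x y)
      edgeArc {x} {y} x≢y x~y = properArc (orient (toℕ x ℕ.<? toℕ y)) (x≢y ∘ pos-inj x y)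
        where
        orient : Dec (toℕ x < toℕ y) → Arc (pos x) (pos y) (OnEdge x y)
        orient (yes x<y) = weakenArc (λ on → _ , on , forward refl) (drawnArc ((x , y) , x<y , x~y))
        orient (no x≮y) = weakenArc (λ on → _ , on , backward refl)
          (reverseArc (drawnArc ((y , x) , y<x , trans (a-sym y x) x~y)))
          where
          y<x : toℕ y < toℕ x
          y<x = ℕ.≤∧≢⇒< (ℕ.≮⇒≥ x≮y) (x≢y ∘ sym ∘ Fin.toℕ-injective)

      -- The edges of G along which the H-edge ij is drawn.
      data Along (i j : Fin m) (e : Edge G) : Set where
        direct : proj₁ e ≡ (ι i , ι j) → Along i j e
        via-u  : adjᵤ i ≡ true → adjᵤ j ≡ true → IsEnd G e u →
                 (∀ {w} → IsEnd G e w → w ≡ u ⊎ w ≡ ι i ⊎ w ≡ ι j) → Along i j e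

      along-ends-ι : ∀ {i j e k} → Along i j e → IsEnd G e (ι k) → k ≡ i ⊎ k ≡ j
      along-ends-ι (direct refl) (inj₁ ιk≡ιi) = inj₁ (ι-injective ιk≡ιi)
      along-ends-ι (direct refl) (inj₂ ιk≡ιj) = inj₂ (ι-injective ιk≡ιj)
      along-ends-ι {k = k} (via-u _ _ _ ends) ιk-end with ends ιk-end
      ... | inj₁ ιk≡u = contradiction ιk≡u (ι≢u k)
      ... | inj₂ (inj₁ ιk≡ιi) = inj₁ (ι-injective ιk≡ιi)
      ... | inj₂ (inj₂ ιk≡ιj) = inj₂ (ι-injective ιk≡ιj)

      along-ends-u : ∀ {i j e} → Along i j e → IsEnd G e u → adjᵤ i ≡ true × adjᵤ j ≡ true
      along-ends-u {i} (direct refl) (inj₁ u≡ιi) = contradiction (sym u≡ιi) (ι≢u i)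
      along-ends-u {j = j} (direct refl) (inj₂ u≡ιj) = contradiction (sym u≡ιj) (ι≢u j)
      along-ends-u (via-u i~u j~u _ _) _ = i~u , j~u

      OnRoute : Fin m → Fin m → Pt → Set
      OnRoute i j p = Σ (Edge G) λ e → OnPath (arc e) p × Along i j e

      Route : Fin m → Fin m → Set
      Route i j = Arc (pos (ι i)) (pos (ι j)) (OnRoute i j)

      routeVia-u : ∀ {i j} → i ≢ j → adjᵤ i ≡ true → adjᵤ j ≡ true → Route i j
      routeVia-u {i} {j} i≢j i~u j~u =
        weakenArc classify (concatArc (edgeArc (ι≢u i) i~u) (edgeArc (ι≢u j ∘ sym) (trans (a-sym u (ι j)) j~u)) meet)
        where
        ιi≢ιj : ι i ≢ ι j
        ιi≢ιj = i≢j ∘ ι-injective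
        distinct : ∀ {e f} → Ends G e (ι i) u → Ends G f u (ι j) → proj₁ e ≢ proj₁ f
        distinct {e} {f} ends-e ends-f e≡f with ends-of ends-f (isEnd-≡ {G} {e} {f} e≡f (isEnd₁ ends-e))
        ... | inj₁ ιi≡u = ι≢u i ιi≡u
        ... | inj₂ ιi≡ιj = ιi≢ιj ιi≡ιj
        -- The edges ι i u and u ι j are distinct, so their drawings meet only in their common end u.
        meet : ∀ {p} → OnEdge (ι i) u p → OnEdge u (ι j) p → p ≡ pos u
        meet {p} (e , on-e , ends-e) (f , on-f , ends-f) with arcs-disjoint e f (distinct ends-e ends-f) p on-e on-f
        ... | x , x-end-e , x-end-f , p≡ with ends-of ends-e x-end-e | ends-of ends-f x-end-f
        ...   | inj₂ x≡u | _ = trans p≡ (cong pos x≡u)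
        ...   | inj₁ _ | inj₁ x≡u = trans p≡ (cong pos x≡u)
        ...   | inj₁ x≡ιi | inj₂ x≡ιj = contradiction (trans (sym x≡ιi) x≡ιj) ιi≢ιj
        classify : OnEdge (ι i) u ∪ OnEdge u (ι j) ⊆ OnRoute i j
        classify (inj₁ (e , on , ends)) = e , on , via-u i~u j~u (isEnd₂ ends) λ w-end → case₁ (ends-of ends w-end)
          where
          case₁ : ∀ {w} → w ≡ ι i ⊎ w ≡ u → w ≡ u ⊎ w ≡ ι i ⊎ w ≡ ι j
          case₁ (inj₁ w≡ιi) = inj₂ (inj₁ w≡ιi)
          case₁ (inj₂ w≡u) = inj₁ w≡u
        classify (inj₂ (e , on , ends)) = e , on , via-u i~u j~u (isEnd₁ ends) λ w-end → case₂ (ends-of ends w-end)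
          where
          case₂ : ∀ {w} → w ≡ u ⊎ w ≡ ι j → w ≡ u ⊎ w ≡ ι i ⊎ w ≡ ι j
          case₂ (inj₁ w≡u) = inj₁ w≡u
          case₂ (inj₂ w≡ιj) = inj₂ (inj₂ w≡ιj)

      route : (E : Edge H) → Route (proj₁ (proj₁ E)) (proj₂ (proj₁ E))
      route ((i , j) , i<j , i~j) with a (ι i) (ι j) in ιi~ιj
      ... | true = weakenArc (λ on → _ , on , direct refl) (drawnArc ((ι i , ι j) , ι-mono , ιi~ιj))
        where
        ι-mono : toℕ (ι i) < toℕ (ι j)
        ι-mono = ℕ.<ᵇ⇒< _ _ (subst T (sym (<ᵇ-punchIn u i j)) (ℕ.<⇒<ᵇ i<j))
      ... | false with adjᵤ i in i~u | adjᵤ j in j~u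
      ...   | true | true = routeVia-u (Fin.<⇒≢ i<j) i~u j~u
      ...   | false | _ = contradiction i~j λ ()
      ...   | true | false = contradiction i~j λ ()

      Carries : Edge H → Edge G → Set
      Carries E = Along (proj₁ (proj₁ E)) (proj₂ (proj₁ E))

      both-via-u : ∀ (E F : Edge H) {e f} → Carries E e → Carries F f → IsEnd G e u → IsEnd G f u → proj₁ E ≡ proj₁ F
      both-via-u (_ , i<j , _) (_ , k<l , _) along-e along-f u-e u-f with along-ends-u along-e u-e | along-ends-u along-f u-f
      ... | i~u , j~u | k~u , l~u = joined-unique i<j k<l i~u j~u k~u l~u

      carriers-distinct : ∀ (E F : Edge H) {e f} → proj₁ E ≢ proj₁ F → Carries E e → Carries F f → proj₁ e ≢ proj₁ f
      carriers-distinct E F E≢F (direct e≡ιiιj) (direct f≡ιkιl) e≡f =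
        E≢F (cong₂ _,_ (ι-injective (cong proj₁ ιiιj≡ιkιl)) (ι-injective (cong proj₂ ιiιj≡ιkιl)))
        where ιiιj≡ιkιl = trans (sym e≡ιiιj) (trans e≡f f≡ιkιl)
      carriers-distinct E F {e} {f} E≢F along-e@(via-u _ _ u-e _) along-f e≡f =
        E≢F (both-via-u E F along-e along-f u-e (isEnd-≡ {G} {e} {f} e≡f u-e))
      carriers-distinct E F {e} {f} E≢F along-e@(direct _) along-f@(via-u _ _ u-f _) e≡f =
        E≢F (both-via-u E F along-e along-f (isEnd-≡ {G} {f} {e} (sym e≡f) u-f) u-f)

      planar-smoothed : PlaneDrawing H
      planar-smoothed = record
        { pos = pos ∘ ι
        ; pos-inj = λ i j eq → ι-injective (pos-inj (ι i) (ι j) eq)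
        ; arc = path ∘ route
        ; arc-isArc = isArc ∘ route
        ; arc-start = start≡ ∘ route
        ; arc-end = end≡ ∘ route
        ; arc-avoids-vertices = avoids
        ; arcs-disjoint = disjoint }
        where
        avoids : ∀ E w → OnPath (path (route E)) (pos (ι w)) → IsEnd H E w
        avoids E w on with inside (route E) on
        ... | e , on-e , along = along-ends-ι along (arc-avoids-vertices e (ι w) on-e)

        disjoint : ∀ E F → proj₁ E ≢ proj₁ F → ∀ p → OnPath (path (route E)) p → OnPath (path (route F)) p →
                   Σ (Fin m) λ k → IsEnd H E k × IsEnd H F k × (p ≡ pos (ι k))
        disjoint E F E≢F p on-E on-F with inside (route E) on-E | inside (route F) on-F
        ... | e , on-e , along-e | f , on-f , along-f
          with arcs-disjoint e f (carriers-distinct E F E≢F along-e along-f) p on-e on-f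
        ... | x , x-e , x-f , p≡ with vertexView x
        ...   | centre = contradiction (both-via-u E F along-e along-f x-e x-f) E≢F
        ...   | other k = k , along-ends-ι along-e x-e , along-ends-ι along-f x-f , p≡

smaller-counterexample : ∀ G u → Counterexample G → deg G u ≤ 2 → Σ Graph λ H → Counterexample H × size H < size G
smaller-counterexample record { n = suc m ; adj = a ; sym = a-sym ; irrefl = a-irrefl } u (planar , maxDeg , uncolourable) deg≤2 =
  H , (planar-smoothed deg≤2 planar , maxDeg-smoothed deg≤2 maxDeg , uncolourable ∘ twoDistanceColorable-smoothed maxDeg few) ,
  size-smoothed deg≤2
  where
  open Smoothing a a-sym a-irrefl u
  few : deg G u * 6 < 16
  few = ℕ.≤-<-trans (ℕ.*-monoˡ-≤ 6 deg≤2) (ℕ.m<m+n 12 {4} z<s)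

lemma2p1 : (G : Graph) → MinimalCounterexample G → MinDegAtLeast 3 G
lemma2p1 G (counterexample , minimal) u with 3 ℕ.≤? deg G u
... | yes 3≤deg = 3≤deg
... | no 3≰deg with smaller-counterexample G u counterexample (ℕ.≤-pred (ℕ.≰⇒> 3≰deg))
...   | H , counterexample-H , H<G = contradiction (minimal H counterexample-H) (ℕ.<⇒≱ H<G)
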